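{- Let $n$ be a positive integer with prime factorization $n=\prod_{i=1}^s p_i^{r_i}$, where the primes $p_i$ are pairwise distinct. Then $$\mathcal{I}(n,2)\ge n\cdot\prod_{i=1}^s p_i^{\lfloor r_i/2\rfloor}.$$
   Context: For a positive integer $n$, $\mathbb{Z}_n=\mathbb{Z}/n\mathbb{Z}$. Two points $(u_1,u_2),(v_1,v_2)\in\mathbb{Z}_n^2$ are at integral distance if there exists $d\in\mathbb{Z}_n$ with $(u_1-v_1)^2+(u_2-v_2)^2=d^2$ in $\mathbb{Z}_n$. An integral point set over $\mathbb{Z}_n^2$ is a subset of $\mathbb{Z}_n^2$ whose points are pairwise at integral distance. $\mathcal{I}(n,2)$ denotes the maximum cardinality of an integral point set over $\mathbb{Z}_n^2$. -}

module Defs where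

open import Data.Nat using (ℕ; zero; suc; _*_; _^_; _/_; _≤_)
open import Data.Fin using (Fin; toℕ) renaming (zero to fz; suc to fs)
open import Data.Integer as ℤ using (ℤ; +_)
open import Data.Integer.Divisibility using () renaming (_∣_ to _∣ℤ_)
open import Data.Product using (_×_; _,_; ∃; ∃-syntax)
open import Data.List using (List; length)
open import Data.List.Relation.Unary.AllPairs using (AllPairs)
open import Relation.Binary.PropositionalEquality using (_≢_)

∏ : (s : ℕ) → (Fin s → ℕ) → ℕ
∏ zero    f = 1
∏ (suc s) f = f fz * ∏ s (λ i → f (fs i))

-- ℤ_n is represented by Fin n (residues 0..n-1); equality in ℤ_n of two
-- integer expressions is congruence modulo n.
ℤₙ : ℕ → Set
ℤₙ n = Fin n

Point : ℕ → Set
Point n = ℤₙ n × ℤₙ n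

ι : ∀ {n} → ℤₙ n → ℤ
ι x = + toℕ x

sq : ℤ → ℤ
sq x = x ℤ.* x

IntegralDistance : (n : ℕ) → Point n → Point n → Set
IntegralDistance n (u₁ , u₂) (v₁ , v₂) =
  ∃[ d ] ((+ n) ∣ℤ ((sq (ι u₁ ℤ.- ι v₁) ℤ.+ sq (ι u₂ ℤ.- ι v₂)) ℤ.- sq (ι {n} d)))

record IntegralPointSet (n : ℕ) : Set where
  field
    points   : List (Point n)
    distinct : AllPairs _≢_ points
    integral : AllPairs (IntegralDistance n) points

card : ∀ {n} → IntegralPointSet n → ℕ
card S = length (IntegralPointSet.points S)

-- 𝓘(n,2) ≥ k : the maximum cardinality of an integral point set over ℤ_n²
-- is at least k, i.e. some integral point set has at least k points.
𝓘₂≥ : ℕ → ℕ → Set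
𝓘₂≥ n k = ∃[ S ] (k ≤ card {n} S)

-- Split every exponent as rᵢ = ⌈rᵢ/2⌉ + ⌊rᵢ/2⌋ and put
--   m = ∏ pᵢ^⌈rᵢ/2⌉,   k = ∏ pᵢ^⌊rᵢ/2⌋,   c = ∏ pᵢ^(rᵢ mod 2),
-- so that n = m·k and m² = n·c; in particular n ∣ m².  Then the "grid"
--   ℤₙ × mℤₙ = { (a , j·m) : a ∈ ℤₙ, 0 ≤ j < k }
-- has n·k points and is integral: for two of its points the squared distance
-- is t² + (j₁−j₂)²m² ≡ t² (mod n), with t = a₁ − a₂, so d = t mod n works.
module Submission where

open import Defs
open import Data.Nat using (ℕ; _*_; _^_; _/_; _≤_)
open import Data.Nat.Primality using (Prime)
open import Data.Fin using (Fin)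
open import Relation.Binary.PropositionalEquality using (_≡_)

open import Data.Nat as ℕ using (zero; suc; _+_; _%_; NonZero; _<_)
import Data.Nat.Properties as ℕP
open import Data.Nat.Divisibility using (divides) renaming (_∣_ to _∣ℕ_)
open import Data.Nat.DivMod using (m≡m%n+[m/n]*n)
open import Data.Fin using (toℕ; fromℕ<; remQuot; combine) renaming (zero to fz; suc to fs)
import Data.Fin.Properties as FP
open import Data.Integer as ℤ using (ℤ; +_)
import Data.Integer.Properties as ℤP
open import Data.Integer.DivMod using (_%ℕ_; _/ℕ_; n%ℕd<d; a≡a%ℕn+[a/ℕn]*n)
open import Data.Integer.Divisibility.Signed as Signed using (∣⇒∣ᵤ; ∣ᵤ⇒∣)
open import Data.Product using (_,_; proj₁; proj₂; uncurry)
open import Data.Product.Properties using (,-injectiveˡ; ,-injectiveʳ)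
open import Data.List using (tabulate)
open import Data.List.Properties using (length-tabulate)
import Data.List.Relation.Unary.AllPairs.Properties as AllPairsP
import Data.List.Relation.Unary.Unique.Propositional.Properties as UniqueP
open import Relation.Binary.PropositionalEquality
  using (refl; sym; trans; cong; cong₂; subst; module ≡-Reasoning)
import Data.Integer.Tactic.RingSolver as ℤSolver
import Data.Nat.Tactic.RingSolver as ℕSolver

-- A number and its remainder modulo n have congruent squares:
-- if t = R + Q·n then t² − R² = Q·(t + R)·n.
square-≡-square-of-remainder : ∀ n .{{_ : NonZero n}} (t : ℤ) →
  (+ n) Signed.∣ (sq t ℤ.- sq (+ (t %ℕ n)))
square-≡-square-of-remainder n t =
  Signed.divides (Q ℤ.* (t ℤ.+ R)) (difference-of-squares t (a≡a%ℕn+[a/ℕn]*n t n))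
  where
    R Q : ℤ
    R = + (t %ℕ n)
    Q = t /ℕ n
    factorisation : ∀ R Q N → (R ℤ.+ Q ℤ.* N) ℤ.* (R ℤ.+ Q ℤ.* N) ℤ.- R ℤ.* R
                              ≡ Q ℤ.* ((R ℤ.+ Q ℤ.* N) ℤ.+ R) ℤ.* N
    factorisation = ℤSolver.solve-∀
    difference-of-squares : ∀ u → u ≡ R ℤ.+ Q ℤ.* + n → sq u ℤ.- sq R ≡ Q ℤ.* (u ℤ.+ R) ℤ.* + n
    difference-of-squares u refl = factorisation R Q (+ n)

square-of-multiple-difference : ∀ {n m} → n ∣ℕ m * m → (x y : ℤ) →
  (+ n) Signed.∣ sq (x ℤ.* + m ℤ.- y ℤ.* + m)
square-of-multiple-difference {n} {m} n∣m² x y =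
  subst ((+ n) Signed.∣_) (sym expand)
    (Signed.∣n⇒∣m*n ((x ℤ.- y) ℤ.* (x ℤ.- y)) (∣ᵤ⇒∣ n∣m²))
  where
    pull-out : ∀ x y M → (x ℤ.* M ℤ.- y ℤ.* M) ℤ.* (x ℤ.* M ℤ.- y ℤ.* M)
                         ≡ (x ℤ.- y) ℤ.* (x ℤ.- y) ℤ.* (M ℤ.* M)
    pull-out = ℤSolver.solve-∀
    expand : sq (x ℤ.* + m ℤ.- y ℤ.* + m) ≡ (x ℤ.- y) ℤ.* (x ℤ.- y) ℤ.* + (m * m)
    expand = trans (pull-out x y (+ m)) (cong ((x ℤ.- y) ℤ.* (x ℤ.- y) ℤ.*_) (sym (ℤP.pos-* m m)))

∣-shift : ∀ {N B : ℤ} (A C : ℤ) → N Signed.∣ (A ℤ.- C) → N Signed.∣ B → N Signed.∣ ((A ℤ.+ B) ℤ.- C)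
∣-shift {N} {B} A C N∣A-C N∣B =
  subst (N Signed.∣_) (regroup A B C) (Signed.∣m∣n⇒∣m+n N∣A-C N∣B)
  where
    regroup : ∀ A B C → (A ℤ.- C) ℤ.+ B ≡ (A ℤ.+ B) ℤ.- C
    regroup = ℤSolver.solve-∀

module Grid (n m k : ℕ) {{_ : NonZero n}} (n≡m*k : n ≡ m * k) (n∣m² : n ∣ℕ m * m) where

  instance
    m-nonZero : NonZero m
    m-nonZero = ℕ.≢-nonZero λ m≡0 → ℕ.≢-nonZero⁻¹ n (trans n≡m*k (cong (_* k) m≡0))

  multiple : Fin k → ℤₙ n
  multiple j = fromℕ< j·m<n
    where
      j·m<n : toℕ j * m < n
      j·m<n = subst (toℕ j * m <_) (trans (ℕP.*-comm k m) (sym n≡m*k))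
                (ℕP.*-monoˡ-< m (FP.toℕ<n j))

  toℕ-multiple : ∀ j → toℕ (multiple j) ≡ toℕ j * m
  toℕ-multiple j = FP.toℕ-fromℕ< _

  ι-multiple : ∀ j → ι (multiple j) ≡ + toℕ j ℤ.* + m
  ι-multiple j = trans (cong +_ (toℕ-multiple j)) (ℤP.pos-* (toℕ j) m)

  multiple-injective : ∀ {i j} → multiple i ≡ multiple j → i ≡ j
  multiple-injective {i} {j} eq = FP.toℕ-injective (ℕP.*-cancelʳ-≡ (toℕ i) (toℕ j) m
    (trans (sym (toℕ-multiple i)) (trans (cong toℕ eq) (toℕ-multiple j))))

  grid-integral : ∀ a₁ a₂ j₁ j₂ → IntegralDistance n (a₁ , multiple j₁) (a₂ , multiple j₂)
  grid-integral a₁ a₂ j₁ j₂ = d , ∣⇒∣ᵤ (∣-shift (sq t) (sq (ι d)) first-coordinate second-coordinate)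
    where
      t : ℤ
      t = ι a₁ ℤ.- ι a₂
      d : ℤₙ n
      d = fromℕ< (n%ℕd<d t n)
      first-coordinate : (+ n) Signed.∣ (sq t ℤ.- sq (ι d))
      first-coordinate = subst (λ R → (+ n) Signed.∣ (sq t ℤ.- sq R))
        (cong +_ (sym (FP.toℕ-fromℕ< (n%ℕd<d t n)))) (square-≡-square-of-remainder n t)
      second-coordinate : (+ n) Signed.∣ sq (ι (multiple j₁) ℤ.- ι (multiple j₂))
      second-coordinate = subst (λ D → (+ n) Signed.∣ sq D)
        (sym (cong₂ ℤ._-_ (ι-multiple j₁) (ι-multiple j₂)))
        (square-of-multiple-difference n∣m² (+ toℕ j₁) (+ toℕ j₂))

  grid-point : Fin (n * k) → Point n
  grid-point x = proj₁ (remQuot {n} k x) , multiple (proj₂ (remQuot {n} k x))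

  grid-point-injective : ∀ {x y} → grid-point x ≡ grid-point y → x ≡ y
  grid-point-injective {x} {y} eq = begin
    x                               ≡⟨ FP.combine-remQuot {n} k x ⟨
    uncurry combine (remQuot {n} k x) ≡⟨ cong₂ combine (,-injectiveˡ eq) (multiple-injective (,-injectiveʳ eq)) ⟩
    uncurry combine (remQuot {n} k y) ≡⟨ FP.combine-remQuot {n} k y ⟩
    y                               ∎
    where open ≡-Reasoning

  grid : IntegralPointSet n
  grid = record
    { points   = tabulate grid-point
    ; distinct = UniqueP.tabulate⁺ grid-point-injective
    ; integral = AllPairsP.tabulate⁺ λ {x} {y} _ →
        grid-integral (proj₁ (remQuot {n} k x)) (proj₁ (remQuot {n} k y))
                      (proj₂ (remQuot {n} k x)) (proj₂ (remQuot {n} k y))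
    }

  grid-size : 𝓘₂≥ n (n * k)
  grid-size = grid , ℕP.≤-reflexive (sym (length-tabulate grid-point))

∏-cong : ∀ s {f g : Fin s → ℕ} → (∀ i → f i ≡ g i) → ∏ s f ≡ ∏ s g
∏-cong zero    f≗g = refl
∏-cong (suc s) f≗g = cong₂ _*_ (f≗g fz) (∏-cong s (λ i → f≗g (fs i)))

∏-* : ∀ s (f g : Fin s → ℕ) → ∏ s (λ i → f i * g i) ≡ ∏ s f * ∏ s g
∏-* zero    f g = refl
∏-* (suc s) f g = trans (cong (f fz * g fz *_) (∏-* s (λ i → f (fs i)) (λ i → g (fs i))))
                        (interchange (f fz) (g fz) (∏ s (λ i → f (fs i))) (∏ s (λ i → g (fs i))))
  where
    interchange : ∀ a b x y → a * b * (x * y) ≡ a * x * (b * y)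
    interchange = ℕSolver.solve-∀

∏-^-split : ∀ s (p e a b : Fin s → ℕ) → (∀ i → e i ≡ a i + b i) →
  ∏ s (λ i → p i ^ e i) ≡ ∏ s (λ i → p i ^ a i) * ∏ s (λ i → p i ^ b i)
∏-^-split s p e a b e≡a+b = trans
  (∏-cong s (λ i → trans (cong (p i ^_) (e≡a+b i)) (ℕP.^-distribˡ-+-* (p i) (a i) (b i))))
  (∏-* s (λ i → p i ^ a i) (λ i → p i ^ b i))

⌈_/2⌉ : ℕ → ℕ
⌈ r /2⌉ = r / 2 + r % 2

ceil+floor : ∀ r → r ≡ ⌈ r /2⌉ + r / 2
ceil+floor r = trans (m≡m%n+[m/n]*n r 2) (rearrange (r / 2) (r % 2))
  where
    rearrange : ∀ h e → e + h * 2 ≡ (h + e) + h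
    rearrange = ℕSolver.solve-∀

ceil+ceil : ∀ r → ⌈ r /2⌉ + ⌈ r /2⌉ ≡ r + r % 2
ceil+ceil r = trans (rearrange (r / 2) (r % 2)) (cong (_+ r % 2) (sym (m≡m%n+[m/n]*n r 2)))
  where
    rearrange : ∀ h e → (h + e) + (h + e) ≡ (e + h * 2) + e
    rearrange = ℕSolver.solve-∀

lemma2 : (n : ℕ) → 1 ≤ n →
    (s : ℕ) (p : Fin s → ℕ) (r : Fin s → ℕ) →
    (∀ i → Prime (p i)) →
    (∀ i j → p i ≡ p j → i ≡ j) →
    (∀ i → 1 ≤ r i) →
    n ≡ ∏ s (λ i → p i ^ r i) →
    𝓘₂≥ n (n * ∏ s (λ i → p i ^ (r i / 2)))
lemma2 n 1≤n s p r _ _ _ n≡∏ = Grid.grid-size n m k {{ℕ.>-nonZero 1≤n}} n≡m*k n∣m²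
  where
    m k c : ℕ
    m = ∏ s (λ i → p i ^ ⌈ r i /2⌉)
    k = ∏ s (λ i → p i ^ (r i / 2))
    c = ∏ s (λ i → p i ^ (r i % 2))
    n≡m*k : n ≡ m * k
    n≡m*k = trans n≡∏ (∏-^-split s p r (λ i → ⌈ r i /2⌉) (λ i → r i / 2) (λ i → ceil+floor (r i)))
    m*m≡n*c : m * m ≡ n * c
    m*m≡n*c = begin
      m * m                            ≡⟨ ∏-^-split s p (λ i → ⌈ r i /2⌉ + ⌈ r i /2⌉) (λ i → ⌈ r i /2⌉) (λ i → ⌈ r i /2⌉) (λ i → refl) ⟨
      ∏ s (λ i → p i ^ (⌈ r i /2⌉ + ⌈ r i /2⌉)) ≡⟨ ∏-cong s (λ i → cong (p i ^_) (ceil+ceil (r i))) ⟩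
      ∏ s (λ i → p i ^ (r i + r i % 2)) ≡⟨ ∏-^-split s p (λ i → r i + r i % 2) r (λ i → r i % 2) (λ i → refl) ⟩
      ∏ s (λ i → p i ^ r i) * c         ≡⟨ cong (_* c) n≡∏ ⟨
      n * c                            ∎
      where open ≡-Reasoning
    n∣m² : n ∣ℕ m * m
    n∣m² = divides c (trans m*m≡n*c (ℕP.*-comm n c))
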